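{- Let $M_1,\ldots,M_k$ be terms in normal form and let $C$ be a $k$-hole $E$-context. If $\Gamma,\downarrow C[M_1,\ldots,M_k]\vdash M$ has a cut-free derivation in $\mathcal S$, then so does $\Gamma,M_1,\ldots,M_k\vdash M$.
   Context: Messages: names and terms built from constructors $\mathsf{pub}$ (unary), $\mathsf{sign}$, $\mathsf{blind}$, $\langle\cdot,\cdot\rangle$, $\{\cdot\}_\cdot$ (binary) and function symbols of a finite signature $\Sigma_E$ disjoint from the constructors; ground. $E$: equational theory over $\Sigma_E$ with at most one AC symbol $\oplus$, presented by a rewrite system terminating and confluent modulo AC; $\equiv$: equality modulo AC; $\approx_E$: modulo $E$; $\downarrow M$: normal form of $M$; terms in sequents are $E$-normal. $E$-alien: headed by a symbol not in $\Sigma_E$; an $E$-alien subterm $A$ of $N$ is an $E$-factor of $N$ if it is an immediate subterm of a subterm of $N$ headed by a symbol of $\Sigma_E$ (of a set: of some member). $E$-context: a term built from holes using only function symbols of $\Sigma_E$; $C[M_1,\ldots,M_k]$ fills its $k$ holes in order with $M_1,\ldots,M_k$. $\Gamma,M$ means $\Gamma\cup\{M\}$. System $\mathcal S$ (premises $\Rightarrow$ conclusion): (id) $\Gamma\vdash M$ if $M\approx_E C[M_1,\ldots,M_k]$ for an $E$-context $C$, $M_i\in\Gamma$; (cut) $\Gamma\vdash M,\Gamma,M\vdash T\Rightarrow\Gamma\vdash T$; ($p_L$) $\Gamma,\langle M,N\rangle,M,N\vdash T\Rightarrow\Gamma,\langle M,N\rangle\vdash T$; ($e_L$) $\Gamma,\{M\}_K\vdash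 K$, $\Gamma,\{M\}_K,M,K\vdash N\Rightarrow\Gamma,\{M\}_K\vdash N$; ($\mathsf{sign}_L$) $\Gamma,\mathsf{sign}(M,K),\mathsf{pub}(L),M\vdash N\Rightarrow\Gamma,\mathsf{sign}(M,K),\mathsf{pub}(L)\vdash N$ if $K\equiv L$; ($\mathsf{blind}_{L1}$) $\Gamma,\mathsf{blind}(M,K)\vdash K$, $\Gamma,\mathsf{blind}(M,K),M,K\vdash N\Rightarrow\Gamma,\mathsf{blind}(M,K)\vdash N$; ($\mathsf{blind}_{L2}$) $\Gamma,\mathsf{sign}(\mathsf{blind}(M,R),K)\vdash R$, $\Gamma,\mathsf{sign}(\mathsf{blind}(M,R),K),\mathsf{sign}(M,K),R\vdash N\Rightarrow\Gamma,\mathsf{sign}(\mathsf{blind}(M,R),K)\vdash N$; (acut) $\Gamma\vdash A,\Gamma,A\vdash M\Rightarrow\Gamma\vdash M$, $A$ an $E$-factor of $\Gamma\cup\{M\}$; right rules: $\Gamma\vdash M,\Gamma\vdash N\Rightarrow\Gamma\vdash g(M,N)$ for $g\in\{\langle\cdot,\cdot\rangle,\{\cdot\}_\cdot,\mathsf{sign},\mathsf{blind}\}$. A derivation is cut-free if it contains no instance of cut. -}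

module Defs where

open import Data.Nat using (ℕ; zero; suc; _+_)
open import Data.Fin using (Fin)
open import Data.Bool using (Bool; true; false)
open import Data.Maybe using (Maybe; just; nothing)
open import Data.Product using (Σ; ∃; _×_; _,_)
open import Data.Sum using (_⊎_)
open import Data.Empty using (⊥)
open import Data.List using (List; _∷_; [])
open import Data.List.Membership.Propositional using () renaming (_∈_ to _∈L_)
open import Data.Vec using (Vec; _∷_; []; take; drop; toList)
open import Data.Vec.Membership.Propositional using () renaming (_∈_ to _∈V_)
import Data.Vec.Relation.Unary.All as VAll
open import Data.List.Relation.Unary.All using (All)
open import Relation.Nullary using (¬_)
open import Relation.Binary.PropositionalEquality using (_≡_; subst) renaming (sym to ≡-sym)
open import Relation.Binary.Construct.Closure.ReflexiveTransitive using (Star)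
open import Induction.WellFounded using (WellFounded)

record Signature : Set where
  field
    nF : ℕ
    ar : Fin nF → ℕ
    acSym : Maybe (Σ (Fin nF) λ f → ar f ≡ 2)
open Signature public

-- Names, the constructors pub, sign, blind, pairing ⟨_,_⟩,
-- encryption {M}_K (enc M K), symbols of Σ_E, and variables (variables
-- are only used in the rewrite rules; messages are ground terms).

data Term (S : Signature) : Set where
  var   : ℕ → Term S
  name  : ℕ → Term S
  pub   : Term S → Term S
  sign  : Term S → Term S → Term S
  blind : Term S → Term S → Term S
  pair  : Term S → Term S → Term S
  enc   : Term S → Term S → Term S
  fun   : (f : Fin (nF S)) → Vec (Term S) (ar S f) → Term S

module _ {S : Signature} where

  Rel : Set₁
  Rel = Term S → Term S → Set

  data _⊑_ : Term S → Term S → Set where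
    here   : ∀ {t} → t ⊑ t
    pub↓   : ∀ {t u} → t ⊑ u → t ⊑ pub u
    sign₁  : ∀ {t u v} → t ⊑ u → t ⊑ sign u v
    sign₂  : ∀ {t u v} → t ⊑ v → t ⊑ sign u v
    blind₁ : ∀ {t u v} → t ⊑ u → t ⊑ blind u v
    blind₂ : ∀ {t u v} → t ⊑ v → t ⊑ blind u v
    pair₁  : ∀ {t u v} → t ⊑ u → t ⊑ pair u v
    pair₂  : ∀ {t u v} → t ⊑ v → t ⊑ pair u v
    enc₁   : ∀ {t u v} → t ⊑ u → t ⊑ enc u v
    enc₂   : ∀ {t u v} → t ⊑ v → t ⊑ enc u v
    fun↓   : ∀ {t u f ts} → t ⊑ u → u ∈V ts → t ⊑ fun f ts

  Ground : Term S → Set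
  Ground t = ∀ x → ¬ (var x ⊑ t)

  data OverΣE : Term S → Set where
    var : ∀ x → OverΣE (var x)
    fun : ∀ f {ts} → VAll.All OverΣE ts → OverΣE (fun f ts)

  mutual
    _⟪_⟫ : Term S → (ℕ → Term S) → Term S
    var x ⟪ σ ⟫ = σ x
    name n ⟪ σ ⟫ = name n
    pub t ⟪ σ ⟫ = pub (t ⟪ σ ⟫)
    sign t u ⟪ σ ⟫ = sign (t ⟪ σ ⟫) (u ⟪ σ ⟫)
    blind t u ⟪ σ ⟫ = blind (t ⟪ σ ⟫) (u ⟪ σ ⟫)
    pair t u ⟪ σ ⟫ = pair (t ⟪ σ ⟫) (u ⟪ σ ⟫)
    enc t u ⟪ σ ⟫ = enc (t ⟪ σ ⟫) (u ⟪ σ ⟫)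
    fun f ts ⟪ σ ⟫ = fun f (substs ts σ)

    substs : ∀ {n} → Vec (Term S) n → (ℕ → Term S) → Vec (Term S) n
    substs [] σ = []
    substs (t ∷ ts) σ = (t ⟪ σ ⟫) ∷ substs ts σ

  mutual
    data Cong (Ax : Rel) : Rel where
      refl  : ∀ {t} → Cong Ax t t
      sym   : ∀ {t u} → Cong Ax t u → Cong Ax u t
      trans : ∀ {t u v} → Cong Ax t u → Cong Ax u v → Cong Ax t v
      ax    : ∀ {t u} → Ax t u → Cong Ax t u
      pub   : ∀ {t t'} → Cong Ax t t' → Cong Ax (pub t) (pub t')
      sign  : ∀ {t t' u u'} → Cong Ax t t' → Cong Ax u u' → Cong Ax (sign t u) (sign t' u')
      blind : ∀ {t t' u u'} → Cong Ax t t' → Cong Ax u u' → Cong Ax (blind t u) (blind t' u')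
      pair  : ∀ {t t' u u'} → Cong Ax t t' → Cong Ax u u' → Cong Ax (pair t u) (pair t' u')
      enc   : ∀ {t t' u u'} → Cong Ax t t' → Cong Ax u u' → Cong Ax (enc t u) (enc t' u')
      fun   : ∀ f {ts us} → Congs Ax ts us → Cong Ax (fun f ts) (fun f us)

    data Congs (Ax : Rel) : ∀ {n} → Vec (Term S) n → Vec (Term S) n → Set where
      []  : Congs Ax [] []
      _∷_ : ∀ {n t u} {ts us : Vec (Term S) n} → Cong Ax t u → Congs Ax ts us → Congs Ax (t ∷ ts) (u ∷ us)

  app2 : (f : Fin (nF S)) → ar S f ≡ 2 → Term S → Term S → Term S
  app2 f p x y = fun f (subst (Vec (Term S)) (≡-sym p) (x ∷ y ∷ []))

  data ACAx : Rel where
    assoc : ∀ {f p} → acSym S ≡ just (f , p) → ∀ x y z →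
            ACAx (app2 f p x (app2 f p y z)) (app2 f p (app2 f p x y) z)
    comm  : ∀ {f p} → acSym S ≡ just (f , p) → ∀ x y →
            ACAx (app2 f p x y) (app2 f p y x)

  _≡AC_ : Rel
  _≡AC_ = Cong ACAx

record Rule (S : Signature) : Set where
  field
    lhs : Term S
    rhs : Term S
    lhsΣE : OverΣE lhs
    rhsΣE : OverΣE rhs
    lhsNotVar : ∀ x → ¬ (lhs ≡ var x)
    varsRL : ∀ x → var x ⊑ rhs → var x ⊑ lhs
open Rule public

module _ {S : Signature} (R : List (Rule S)) where

  mutual
    data Step : Rel where
      root   : ∀ {r} → r ∈L R → (σ : ℕ → Term S) → Step (lhs r ⟪ σ ⟫) (rhs r ⟪ σ ⟫)
      pub    : ∀ {t t'} → Step t t' → Step (pub t) (pub t')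
      sign₁  : ∀ {t t' u} → Step t t' → Step (sign t u) (sign t' u)
      sign₂  : ∀ {t u u'} → Step u u' → Step (sign t u) (sign t u')
      blind₁ : ∀ {t t' u} → Step t t' → Step (blind t u) (blind t' u)
      blind₂ : ∀ {t u u'} → Step u u' → Step (blind t u) (blind t u')
      pair₁  : ∀ {t t' u} → Step t t' → Step (pair t u) (pair t' u)
      pair₂  : ∀ {t u u'} → Step u u' → Step (pair t u) (pair t u')
      enc₁   : ∀ {t t' u} → Step t t' → Step (enc t u) (enc t' u)
      enc₂   : ∀ {t u u'} → Step u u' → Step (enc t u) (enc t u')
      fun    : ∀ f {ts us} → Steps ts us → Step (fun f ts) (fun f us)

    data Steps : ∀ {n} → Vec (Term S) n → Vec (Term S) n → Set where
      here  : ∀ {n t u} {ts : Vec (Term S) n} → Step t u → Steps (t ∷ ts) (u ∷ ts)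
      there : ∀ {n t} {ts us : Vec (Term S) n} → Steps ts us → Steps (t ∷ ts) (t ∷ us)

  _⟶AC_ : Rel
  t ⟶AC u = ∃ λ t' → ∃ λ u' → t ≡AC t' × Step t' u' × u' ≡AC u

  _⟶AC*_ : Rel
  _⟶AC*_ = Star _⟶AC_

  data EAx : Rel where
    ac   : ∀ {t u} → ACAx t u → EAx t u
    rule : ∀ {r} → r ∈L R → (σ : ℕ → Term S) → EAx (lhs r ⟪ σ ⟫) (rhs r ⟪ σ ⟫)

record Theory (S : Signature) : Set where
  field
    rules : List (Rule S)
    terminating : WellFounded (λ u t → _⟶AC_ rules t u)
    confluent : ∀ {t u₁ u₂} → _⟶AC*_ rules t u₁ → _⟶AC*_ rules t u₂ →
                ∃ λ v₁ → ∃ λ v₂ → _⟶AC*_ rules u₁ v₁ × _⟶AC*_ rules u₂ v₂ × v₁ ≡AC v₂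
open Theory public

module _ {S : Signature} (E : Theory S) where

  _≈E_ : Rel
  _≈E_ = Cong (EAx (rules E))

  Normal : Term S → Set
  Normal t = ¬ (∃ λ u → _⟶AC_ (rules E) t u)

  IsNormalFormOf : Term S → Term S → Set
  IsNormalFormOf N t = _⟶AC*_ (rules E) t N × Normal N

  NormalMsg : Term S → Set
  NormalMsg t = Ground t × Normal t

module _ {S : Signature} where

  -- E-contexts with k holes, filled left to right

  mutual
    data ECtx : ℕ → Set where
      hole : ECtx 1
      fun  : ∀ {k} (f : Fin (nF S)) → ECtxs (ar S f) k → ECtx k

    data ECtxs : ℕ → ℕ → Set where
      []  : ECtxs 0 0
      _∷_ : ∀ {k n l} → ECtx k → ECtxs n l → ECtxs (suc n) (k + l)

  mutual
    fill : ∀ {k} → ECtx k → Vec (Term S) k → Term S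
    fill hole (t ∷ []) = t
    fill (fun f cs) ts = fun f (fills cs ts)

    fills : ∀ {n k} → ECtxs n k → Vec (Term S) k → Vec (Term S) n
    fills [] ts = []
    fills (_∷_ {k} c cs) ts = fill c (take k ts) ∷ fills cs (drop k ts)

  data EAlien : Term S → Set where
    name  : ∀ n → EAlien (name n)
    pub   : ∀ t → EAlien (pub t)
    sign  : ∀ t u → EAlien (sign t u)
    blind : ∀ t u → EAlien (blind t u)
    pair  : ∀ t u → EAlien (pair t u)
    enc   : ∀ t u → EAlien (enc t u)

  EFactor : Term S → Term S → Set
  EFactor A N = EAlien A ×
    ∃ λ f → ∃ λ (ts : Vec (Term S) (ar S f)) → (fun f ts ⊑ N) × (A ∈V ts)

  EFactorOfSet : Term S → List (Term S) → Set
  EFactorOfSet A Γ = ∃ λ N → N ∈L Γ × EFactor A N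

-- Antecedents Γ are sets, represented as lists;
-- "Γ, A" in a conclusion is expressed by requiring A ∈ Γ, and in a
-- premise by consing A.

module _ {S : Signature} (E : Theory S) where

  data Deriv (cutOK : Bool) (Γ : List (Term S)) : Term S → Set where
    id     : ∀ {M k} (C : ECtx k) (Ms : Vec (Term S) k) →
             All (_∈L Γ) (toList Ms) → _≈E_ E M (fill C Ms) → Deriv cutOK Γ M
    cut    : ∀ {M T} → cutOK ≡ true → NormalMsg E M →
             Deriv cutOK Γ M → Deriv cutOK (M ∷ Γ) T → Deriv cutOK Γ T
    pairL  : ∀ {M N T} → pair M N ∈L Γ →
             Deriv cutOK (M ∷ N ∷ Γ) T → Deriv cutOK Γ T
    encL   : ∀ {M K N} → enc M K ∈L Γ → Deriv cutOK Γ K →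
             Deriv cutOK (M ∷ K ∷ Γ) N → Deriv cutOK Γ N
    signL  : ∀ {M K L N} → sign M K ∈L Γ → pub L ∈L Γ → K ≡AC L →
             Deriv cutOK (M ∷ Γ) N → Deriv cutOK Γ N
    blindL1 : ∀ {M K N} → blind M K ∈L Γ → Deriv cutOK Γ K →
             Deriv cutOK (M ∷ K ∷ Γ) N → Deriv cutOK Γ N
    blindL2 : ∀ {M R K N} → sign (blind M R) K ∈L Γ → Deriv cutOK Γ R →
             Deriv cutOK (sign M K ∷ R ∷ Γ) N → Deriv cutOK Γ N
    acut   : ∀ {A M} → EFactorOfSet A (M ∷ Γ) → Deriv cutOK Γ A →
             Deriv cutOK (A ∷ Γ) M → Deriv cutOK Γ M
    pairR  : ∀ {M N} → Deriv cutOK Γ M → Deriv cutOK Γ N → Deriv cutOK Γ (pair M N)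
    encR   : ∀ {M N} → Deriv cutOK Γ M → Deriv cutOK Γ N → Deriv cutOK Γ (enc M N)
    signR  : ∀ {M N} → Deriv cutOK Γ M → Deriv cutOK Γ N → Deriv cutOK Γ (sign M N)
    blindR : ∀ {M N} → Deriv cutOK Γ M → Deriv cutOK Γ N → Deriv cutOK Γ (blind M N)

  CutFree : List (Term S) → Term S → Set
  CutFree = Deriv false

module Submission where

-- Put Δ = M₁,…,Mₖ,Γ.  A cut-free derivation of Γ' ⊢ M is translated, by induction
-- on it, into one of Δ ⊢ M' for every M' ≡AC M, provided Δ represents every
-- hypothesis X of Γ':  (i) X is E-generated from Δ (X ≈E D[Ys] with Ys ∈ Δ, so
-- Δ ⊢ X by (id)), and (ii) every E-factor of X, and X itself if it is E-alien, is
-- available in Δ, i.e. AC-equal to a member or to an E-factor of Δ.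
-- A left rule needs its alien hypothesis in Δ: by (ii) it is there up to AC or it
-- is an E-factor of Δ and one (acut), justified by (i), adds it; as AC preserves
-- head constructors the rule then applies.  An (acut) on an E-factor of Γ' is by
-- (ii) redundant or an (acut) on an E-factor of Δ.  The right rules and (id) are
-- immediate.  Finally ↓C[M₁,…,Mₖ] is represented by Δ: (i) since it is E-equal to
-- C[M₁,…,Mₖ], and (ii) since C[M₁,…,Mₖ] has property (ii) and rewriting preserves
-- it when Δ is normal: a step below an available alien would rewrite a member of
-- Δ, and a Σ_E-rule instance only rearranges the E-factors of its left side.

open import Defs
open import Data.Nat using (ℕ; _+_)
open import Data.Fin using (Fin)
open import Data.Product using (∃; _×_; _,_; proj₁; proj₂; swap)
open import Data.Sum using (_⊎_; inj₁; inj₂; [_,_])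
open import Data.Empty using (⊥-elim)
open import Relation.Nullary using (¬_)
open import Data.Vec using (Vec; toList; _∷_; []; take; drop) renaming (_++_ to _++V_)
open import Data.List using (List; _∷_; _++_)
open import Data.List.Relation.Unary.All using (All) renaming (lookup to All-lookup; tabulate to All-tabulate)
import Data.List.Relation.Unary.All.Properties as AllP
import Data.Vec.Relation.Unary.All as VAll
open VAll using (_∷_; [])
import Data.Vec.Relation.Unary.All.Properties as VAllP
open import Data.List.Relation.Unary.Any using (here; there)
open import Data.Vec.Relation.Unary.Any using (here; there)
open import Data.List.Membership.Propositional using (_∈_)
open import Data.List.Membership.Propositional.Properties using (∈-++⁺ˡ; ∈-++⁺ʳ)
open import Data.Vec.Membership.Propositional using () renaming (_∈_ to _∈V_)
open import Relation.Binary.PropositionalEquality using (_≡_; refl; subst; cong) renaming (sym to ≡-sym)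
open import Relation.Binary.Construct.Closure.ReflexiveTransitive using (ε; _◅_)

module _ {A : Set} where

  -- Splitting a concatenation again (take/drop are computed by splitAt, which does
  -- not reduce on an abstract prefix).
  take-++ : ∀ {k l} (xs : Vec A k) (ys : Vec A l) → take k (xs ++V ys) ≡ xs
  take-++ [] ys = refl
  take-++ (x ∷ xs) ys = cong (x ∷_) (take-++ xs ys)

  drop-++ : ∀ {k l} (xs : Vec A k) (ys : Vec A l) → drop k (xs ++V ys) ≡ ys
  drop-++ [] ys = refl
  drop-++ (x ∷ xs) ys = drop-++ xs ys

  ∈-binary⁻ : ∀ {n} (q : 2 ≡ n) {x a b : A} → x ∈V subst (Vec A) q (a ∷ b ∷ []) → x ≡ a ⊎ x ≡ b
  ∈-binary⁻ refl (here e) = inj₁ e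
  ∈-binary⁻ refl (there (here e)) = inj₂ e
  ∈-binary⁻ refl (there (there ()))

  ∈-binaryˡ : ∀ {n} (q : 2 ≡ n) {a b : A} → a ∈V subst (Vec A) q (a ∷ b ∷ [])
  ∈-binaryˡ refl = here refl

  ∈-binaryʳ : ∀ {n} (q : 2 ≡ n) {a b : A} → b ∈V subst (Vec A) q (a ∷ b ∷ [])
  ∈-binaryʳ refl = there (here refl)

module _ {S : Signature} where

  ⊑-trans : {a b c : Term S} → a ⊑ b → b ⊑ c → a ⊑ c
  ⊑-trans p here = p
  ⊑-trans p (pub↓ q) = pub↓ (⊑-trans p q)
  ⊑-trans p (sign₁ q) = sign₁ (⊑-trans p q)
  ⊑-trans p (sign₂ q) = sign₂ (⊑-trans p q)
  ⊑-trans p (blind₁ q) = blind₁ (⊑-trans p q)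
  ⊑-trans p (blind₂ q) = blind₂ (⊑-trans p q)
  ⊑-trans p (pair₁ q) = pair₁ (⊑-trans p q)
  ⊑-trans p (pair₂ q) = pair₂ (⊑-trans p q)
  ⊑-trans p (enc₁ q) = enc₁ (⊑-trans p q)
  ⊑-trans p (enc₂ q) = enc₂ (⊑-trans p q)
  ⊑-trans p (fun↓ q m) = fun↓ (⊑-trans p q) m

  mutual
    Cong-map : {Ax Ax' : Rel {S}} → (∀ {a b} → Ax a b → Ax' a b) → ∀ {t u} → Cong Ax t u → Cong Ax' t u
    Cong-map h refl = refl
    Cong-map h (sym c) = sym (Cong-map h c)
    Cong-map h (trans c d) = trans (Cong-map h c) (Cong-map h d)
    Cong-map h (ax a) = ax (h a)
    Cong-map h (pub c) = pub (Cong-map h c)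
    Cong-map h (sign c d) = sign (Cong-map h c) (Cong-map h d)
    Cong-map h (blind c d) = blind (Cong-map h c) (Cong-map h d)
    Cong-map h (pair c d) = pair (Cong-map h c) (Cong-map h d)
    Cong-map h (enc c d) = enc (Cong-map h c) (Cong-map h d)
    Cong-map h (fun f cs) = fun f (Congs-map h cs)

    Congs-map : {Ax Ax' : Rel {S}} → (∀ {a b} → Ax a b → Ax' a b) →
                ∀ {n} {ts us : Vec (Term S) n} → Congs Ax ts us → Congs Ax' ts us
    Congs-map h [] = []
    Congs-map h (c ∷ cs) = Cong-map h c ∷ Congs-map h cs

  Congs-refl : {Ax : Rel {S}} → ∀ {n} {ts : Vec (Term S) n} → Congs Ax ts ts
  Congs-refl {ts = []} = []
  Congs-refl {ts = t ∷ ts} = refl ∷ Congs-refl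

  mutual
    fill-closed : (P : Term S → Set) → (∀ {f} {ts : Vec (Term S) (ar S f)} → VAll.All P ts → P (fun f ts)) →
                  ∀ {k} (C : ECtx k) {Ys : Vec (Term S) k} → VAll.All P Ys → P (fill C Ys)
    fill-closed P h hole (p ∷ []) = p
    fill-closed P h (fun f cs) ps = h (fills-closed P h cs ps)

    fills-closed : (P : Term S → Set) → (∀ {f} {ts : Vec (Term S) (ar S f)} → VAll.All P ts → P (fun f ts)) →
                   ∀ {n k} (cs : ECtxs n k) {Ys : Vec (Term S) k} → VAll.All P Ys → VAll.All P (fills cs Ys)
    fills-closed P h [] ps = []
    fills-closed P h (_∷_ {k} c cs) ps =
      fill-closed P h c (VAllP.take⁺ k ps) ∷ fills-closed P h cs (VAllP.drop⁺ k ps)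

  BinaryShape : (Term S → Term S → Term S) → Term S → Term S → Term S → Set
  BinaryShape op a b u = ∃ λ a' → ∃ λ b' → u ≡ op a' b' × a ≡AC a' × b ≡AC b'

  SameHead : Term S → Term S → Set
  SameHead (var x) u = u ≡ var x
  SameHead (name n) u = u ≡ name n
  SameHead (pub a) u = ∃ λ a' → u ≡ pub a' × a ≡AC a'
  SameHead (sign a b) u = BinaryShape sign a b u
  SameHead (blind a b) u = BinaryShape blind a b u
  SameHead (pair a b) u = BinaryShape pair a b u
  SameHead (enc a b) u = BinaryShape enc a b u
  SameHead (fun f ts) u = ∃ λ g → ∃ λ (us : Vec (Term S) (ar S g)) → u ≡ fun g us

  SameHead-refl : ∀ t → SameHead t t
  SameHead-refl (var x) = refl
  SameHead-refl (name n) = refl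
  SameHead-refl (pub a) = a , refl , refl
  SameHead-refl (sign a b) = a , b , refl , refl , refl
  SameHead-refl (blind a b) = a , b , refl , refl , refl
  SameHead-refl (pair a b) = a , b , refl , refl , refl
  SameHead-refl (enc a b) = a , b , refl , refl , refl
  SameHead-refl (fun f ts) = f , ts , refl

  SameHead-sym : ∀ {t u} → SameHead t u → SameHead u t
  SameHead-sym {var x} refl = refl
  SameHead-sym {name n} refl = refl
  SameHead-sym {pub a} (a' , refl , c) = a , refl , sym c
  SameHead-sym {sign a b} (a' , b' , refl , c , d) = a , b , refl , sym c , sym d
  SameHead-sym {blind a b} (a' , b' , refl , c , d) = a , b , refl , sym c , sym d
  SameHead-sym {pair a b} (a' , b' , refl , c , d) = a , b , refl , sym c , sym d
  SameHead-sym {enc a b} (a' , b' , refl , c , d) = a , b , refl , sym c , sym d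
  SameHead-sym {fun f ts} (g , us , refl) = f , ts , refl

  SameHead-trans : ∀ {t u v} → SameHead t u → SameHead u v → SameHead t v
  SameHead-trans {var x} refl h = h
  SameHead-trans {name n} refl h = h
  SameHead-trans {pub a} (_ , refl , c) (a'' , refl , c') = a'' , refl , trans c c'
  SameHead-trans {sign a b} (_ , _ , refl , c , d) (a'' , b'' , refl , c' , d') = a'' , b'' , refl , trans c c' , trans d d'
  SameHead-trans {blind a b} (_ , _ , refl , c , d) (a'' , b'' , refl , c' , d') = a'' , b'' , refl , trans c c' , trans d d'
  SameHead-trans {pair a b} (_ , _ , refl , c , d) (a'' , b'' , refl , c' , d') = a'' , b'' , refl , trans c c' , trans d d'
  SameHead-trans {enc a b} (_ , _ , refl , c , d) (a'' , b'' , refl , c' , d') = a'' , b'' , refl , trans c c' , trans d d'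
  SameHead-trans {fun f ts} (_ , _ , refl) (g , us , refl) = g , us , refl

  -- AC axioms only act below symbols of Σ_E.
  sameHead : ∀ {t u} → t ≡AC u → SameHead t u
  sameHead {t} refl = SameHead-refl t
  sameHead (sym c) = SameHead-sym (sameHead c)
  sameHead (trans c d) = SameHead-trans (sameHead c) (sameHead d)
  sameHead (ax (assoc {f} e x y z)) = f , _ , refl
  sameHead (ax (comm {f} e x y)) = f , _ , refl
  sameHead (pub c) = _ , refl , c
  sameHead (sign c d) = _ , _ , refl , c , d
  sameHead (blind c d) = _ , _ , refl , c , d
  sameHead (pair c d) = _ , _ , refl , c , d
  sameHead (enc c d) = _ , _ , refl , c , d
  sameHead (fun f cs) = f , _ , refl

  alien-AC : ∀ {t u} → t ≡AC u → EAlien t → EAlien u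
  alien-AC c (name n) with sameHead c
  ... | refl = name n
  alien-AC c (pub a) with sameHead c
  ... | a' , refl , _ = pub a'
  alien-AC c (sign a b) with sameHead c
  ... | a' , b' , refl , _ = sign a' b'
  alien-AC c (blind a b) with sameHead c
  ... | a' , b' , refl , _ = blind a' b'
  alien-AC c (pair a b) with sameHead c
  ... | a' , b' , refl , _ = pair a' b'
  alien-AC c (enc a b) with sameHead c
  ... | a' , b' , refl , _ = enc a' b'

  -- The E-factors that an argument w of a Σ_E-symbol contributes: w itself when
  -- w is E-alien, and the E-factors of w.
  FactorOrSelf : Term S → Term S → Set
  FactorOrSelf B w = (EAlien B × B ≡ w) ⊎ EFactor B w

  factor-⊑ : ∀ {B x t : Term S} → EFactor B x → x ⊑ t → EFactor B t
  factor-⊑ (al , g , us , s , m) p = al , g , us , ⊑-trans s p , m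

  factor-arg : ∀ {B w : Term S} {f} {ts : Vec (Term S) (ar S f)} → w ∈V ts → FactorOrSelf B w → EFactor B (fun f ts)
  factor-arg m (inj₁ (al , refl)) = al , _ , _ , here , m
  factor-arg m (inj₂ e) = factor-⊑ e (fun↓ here m)

  factor-fun⁻ : ∀ {B : Term S} {f} {ts : Vec (Term S) (ar S f)} → EFactor B (fun f ts) →
                ∃ λ w → w ∈V ts × FactorOrSelf B w
  factor-fun⁻ (al , g , us , here , m) = _ , m , inj₁ (al , refl)
  factor-fun⁻ (al , g , us , fun↓ s m' , m) = _ , m' , inj₂ (al , g , us , s , m)

  factorOrSelf-fun : ∀ {B : Term S} {f} {ts : Vec (Term S) (ar S f)} → FactorOrSelf B (fun f ts) → EFactor B (fun f ts)
  factorOrSelf-fun (inj₁ (() , refl))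
  factorOrSelf-fun (inj₂ e) = e

  module _ {f : Fin (nF S)} (p : ar S f ≡ 2) where

    private
      _⊕_ : Term S → Term S → Term S
      _⊕_ = app2 f p

    factor-⊕⁻ : ∀ {B x y} → EFactor B (x ⊕ y) → FactorOrSelf B x ⊎ FactorOrSelf B y
    factor-⊕⁻ e with factor-fun⁻ e
    ... | w , m , fw with ∈-binary⁻ (≡-sym p) m
    ... | inj₁ refl = inj₁ fw
    ... | inj₂ refl = inj₂ fw

    factor-⊕ˡ : ∀ {B x y} → FactorOrSelf B x → EFactor B (x ⊕ y)
    factor-⊕ˡ = factor-arg (∈-binaryˡ (≡-sym p))

    factor-⊕ʳ : ∀ {B x y} → FactorOrSelf B y → EFactor B (x ⊕ y)
    factor-⊕ʳ = factor-arg (∈-binaryʳ (≡-sym p))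

    factor-assoc⁺ : ∀ {B} x y z → EFactor B (x ⊕ (y ⊕ z)) → EFactor B ((x ⊕ y) ⊕ z)
    factor-assoc⁺ x y z e with factor-⊕⁻ e
    ... | inj₁ fx = factor-⊕ˡ (inj₂ (factor-⊕ˡ fx))
    ... | inj₂ fyz with factor-⊕⁻ (factorOrSelf-fun fyz)
    ...   | inj₁ fy = factor-⊕ˡ (inj₂ (factor-⊕ʳ fy))
    ...   | inj₂ fz = factor-⊕ʳ fz

    factor-assoc⁻ : ∀ {B} x y z → EFactor B ((x ⊕ y) ⊕ z) → EFactor B (x ⊕ (y ⊕ z))
    factor-assoc⁻ x y z e with factor-⊕⁻ e
    ... | inj₂ fz = factor-⊕ʳ (inj₂ (factor-⊕ʳ fz))
    ... | inj₁ fxy with factor-⊕⁻ (factorOrSelf-fun fxy)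
    ...   | inj₁ fx = factor-⊕ˡ fx
    ...   | inj₂ fy = factor-⊕ʳ (inj₂ (factor-⊕ˡ fy))

    factor-comm : ∀ {B} x y → EFactor B (x ⊕ y) → EFactor B (y ⊕ x)
    factor-comm x y e = [ factor-⊕ʳ , factor-⊕ˡ ] (factor-⊕⁻ e)

  ACFactor : Term S → Term S → Set
  ACFactor B u = ∃ λ B' → B ≡AC B' × EFactor B' u

  _⊆F_ : Term S → Term S → Set
  t ⊆F u = ∀ {B} → EFactor B t → ACFactor B u

  ⊆F-refl : ∀ {t} → t ⊆F t
  ⊆F-refl e = _ , refl , e

  ⊆F-trans : ∀ {t u v} → t ⊆F u → u ⊆F v → t ⊆F v
  ⊆F-trans h k e with h e
  ... | B' , c , e' with k e'
  ... | B'' , c' , e'' = B'' , trans c c' , e''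

  ⊆F-of : ∀ {t u} → (∀ {B} → EFactor B t → EFactor B u) → t ⊆F u
  ⊆F-of h e = _ , refl , h e

  ACFactor-⊑ : ∀ {B x t} → ACFactor B x → x ⊑ t → ACFactor B t
  ACFactor-⊑ (B' , c , e) s = B' , c , factor-⊑ e s

  -- Compatibility of ⊆F with the constructors: E-factors of an alien term are
  -- E-factors of its arguments.
  ⊆F-pub : ∀ {a a'} → a ⊆F a' → pub a ⊆F pub a'
  ⊆F-pub h (al , g , us , pub↓ s , m) = ACFactor-⊑ (h (al , g , us , s , m)) (pub↓ here)

  ⊆F-sign : ∀ {a a' b b'} → a ⊆F a' → b ⊆F b' → sign a b ⊆F sign a' b'
  ⊆F-sign h k (al , g , us , sign₁ s , m) = ACFactor-⊑ (h (al , g , us , s , m)) (sign₁ here)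
  ⊆F-sign h k (al , g , us , sign₂ s , m) = ACFactor-⊑ (k (al , g , us , s , m)) (sign₂ here)

  ⊆F-blind : ∀ {a a' b b'} → a ⊆F a' → b ⊆F b' → blind a b ⊆F blind a' b'
  ⊆F-blind h k (al , g , us , blind₁ s , m) = ACFactor-⊑ (h (al , g , us , s , m)) (blind₁ here)
  ⊆F-blind h k (al , g , us , blind₂ s , m) = ACFactor-⊑ (k (al , g , us , s , m)) (blind₂ here)

  ⊆F-pair : ∀ {a a' b b'} → a ⊆F a' → b ⊆F b' → pair a b ⊆F pair a' b'
  ⊆F-pair h k (al , g , us , pair₁ s , m) = ACFactor-⊑ (h (al , g , us , s , m)) (pair₁ here)
  ⊆F-pair h k (al , g , us , pair₂ s , m) = ACFactor-⊑ (k (al , g , us , s , m)) (pair₂ here)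

  ⊆F-enc : ∀ {a a' b b'} → a ⊆F a' → b ⊆F b' → enc a b ⊆F enc a' b'
  ⊆F-enc h k (al , g , us , enc₁ s , m) = ACFactor-⊑ (h (al , g , us , s , m)) (enc₁ here)
  ⊆F-enc h k (al , g , us , enc₂ s , m) = ACFactor-⊑ (k (al , g , us , s , m)) (enc₂ here)

  factorOrSelf-AC : ∀ {B w w'} → w ≡AC w' → w ⊆F w' → FactorOrSelf B w →
                    ∃ λ B' → B ≡AC B' × FactorOrSelf B' w'
  factorOrSelf-AC c h (inj₁ (al , refl)) = _ , c , inj₁ (alien-AC c al , refl)
  factorOrSelf-AC c h (inj₂ e) = let (B' , cB , e') = h e in B' , cB , inj₂ e'

  ArgsCovered : ∀ {n} → Vec (Term S) n → Vec (Term S) n → Set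
  ArgsCovered ts us = ∀ {w} → w ∈V ts → ∃ λ w' → w' ∈V us × w ≡AC w' × w ⊆F w'

  ⊆F-fun : ∀ {f} {ts us : Vec (Term S) (ar S f)} → ArgsCovered ts us → fun f ts ⊆F fun f us
  ⊆F-fun h e with factor-fun⁻ e
  ... | w , m , fw with h m
  ... | w' , m' , c , inc with factorOrSelf-AC c inc fw
  ... | B' , cB , fw' = B' , cB , factor-arg m' fw'

  mutual
    ⊆F-AC : ∀ {t u} → t ≡AC u → t ⊆F u × u ⊆F t
    ⊆F-AC refl = ⊆F-refl , ⊆F-refl
    ⊆F-AC (sym c) = swap (⊆F-AC c)
    ⊆F-AC (trans c d) = ⊆F-trans (proj₁ (⊆F-AC c)) (proj₁ (⊆F-AC d)) ,
                        ⊆F-trans (proj₂ (⊆F-AC d)) (proj₂ (⊆F-AC c))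
    ⊆F-AC (ax (assoc {p = p} _ x y z)) = ⊆F-of (factor-assoc⁺ p x y z) , ⊆F-of (factor-assoc⁻ p x y z)
    ⊆F-AC (ax (comm {p = p} _ x y)) = ⊆F-of (factor-comm p x y) , ⊆F-of (factor-comm p y x)
    ⊆F-AC (pub c) = ⊆F-pub (proj₁ (⊆F-AC c)) , ⊆F-pub (proj₂ (⊆F-AC c))
    ⊆F-AC (sign c d) = ⊆F-sign (proj₁ (⊆F-AC c)) (proj₁ (⊆F-AC d)) , ⊆F-sign (proj₂ (⊆F-AC c)) (proj₂ (⊆F-AC d))
    ⊆F-AC (blind c d) = ⊆F-blind (proj₁ (⊆F-AC c)) (proj₁ (⊆F-AC d)) , ⊆F-blind (proj₂ (⊆F-AC c)) (proj₂ (⊆F-AC d))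
    ⊆F-AC (pair c d) = ⊆F-pair (proj₁ (⊆F-AC c)) (proj₁ (⊆F-AC d)) , ⊆F-pair (proj₂ (⊆F-AC c)) (proj₂ (⊆F-AC d))
    ⊆F-AC (enc c d) = ⊆F-enc (proj₁ (⊆F-AC c)) (proj₁ (⊆F-AC d)) , ⊆F-enc (proj₂ (⊆F-AC c)) (proj₂ (⊆F-AC d))
    ⊆F-AC (fun f cs) = ⊆F-fun (proj₁ (args-AC cs)) , ⊆F-fun (proj₂ (args-AC cs))

    args-AC : ∀ {n} {ts us : Vec (Term S) n} → Congs ACAx ts us → ArgsCovered ts us × ArgsCovered us ts
    args-AC [] = (λ ()) , (λ ())
    args-AC (_∷_ {t = t} {u} {ts} {us} c cs) = forward , backward
      where
        forward : ArgsCovered (t ∷ ts) (u ∷ us)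
        forward (here refl) = _ , here refl , c , proj₁ (⊆F-AC c)
        forward (there m) = let (w' , m' , cw , h) = proj₁ (args-AC cs) m in w' , there m' , cw , h
        backward : ArgsCovered (u ∷ us) (t ∷ ts)
        backward (here refl) = _ , here refl , sym c , proj₂ (⊆F-AC c)
        backward (there m) = let (w' , m' , cw , h) = proj₂ (args-AC cs) m in w' , there m' , cw , h

  Ctxt : Set
  Ctxt = List (Term S)

  _⊆_ : Ctxt → Ctxt → Set
  Δ ⊆ Δ' = ∀ {x} → x ∈ Δ → x ∈ Δ'

  Available : Ctxt → Term S → Set
  Available Δ B = ∃ λ A → B ≡AC A × (A ∈ Δ ⊎ EFactorOfSet A Δ)

  FactorsAvailable : Ctxt → Term S → Set
  FactorsAvailable Δ t = ∀ {B} → FactorOrSelf B t → Available Δ B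

  available-mono : ∀ {Δ Δ' B} → Δ ⊆ Δ' → Available Δ B → Available Δ' B
  available-mono sub (A , c , inj₁ m) = A , c , inj₁ (sub m)
  available-mono sub (A , c , inj₂ (N , m , e)) = A , c , inj₂ (N , sub m , e)

  available-AC : ∀ {Δ B B'} → B ≡AC B' → Available Δ B' → Available Δ B
  available-AC c (A , c' , x) = A , trans c c' , x

  factorsAvailable-mem : ∀ {Δ Y} → Y ∈ Δ → FactorsAvailable Δ Y
  factorsAvailable-mem m (inj₁ (al , refl)) = _ , refl , inj₁ m
  factorsAvailable-mem {Y = Y} m (inj₂ e) = _ , refl , inj₂ (Y , m , e)

  factorsAvailable-AC : ∀ {Δ t u} → t ≡AC u → FactorsAvailable Δ t → FactorsAvailable Δ u
  factorsAvailable-AC c h fu =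
    let (B' , cB , ft) = factorOrSelf-AC (sym c) (proj₂ (⊆F-AC c)) fu in available-AC cB (h ft)

  factorsAvailable-fun⁺ : ∀ {Δ f} {ts : Vec (Term S) (ar S f)} →
                          (∀ {w} → w ∈V ts → FactorsAvailable Δ w) → FactorsAvailable Δ (fun f ts)
  factorsAvailable-fun⁺ h ff = let (w , m , fw) = factor-fun⁻ (factorOrSelf-fun ff) in h m fw

  factorsAvailable-fun⁻ : ∀ {Δ f w} {ts : Vec (Term S) (ar S f)} →
                          FactorsAvailable Δ (fun f ts) → w ∈V ts → FactorsAvailable Δ w
  factorsAvailable-fun⁻ h m fw = h (inj₂ (factor-arg m fw))

  ∈-substs : ∀ {n} {ts : Vec (Term S) n} {v} (σ : ℕ → Term S) → v ∈V ts → (v ⟪ σ ⟫) ∈V substs ts σ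
  ∈-substs {ts = _ ∷ _} σ (here refl) = here refl
  ∈-substs {ts = _ ∷ _} σ (there m) = there (∈-substs σ m)

  factorsAvailable-var : ∀ {Δ x w} (σ : ℕ → Term S) → var x ⊑ w → OverΣE w →
                         FactorsAvailable Δ (w ⟪ σ ⟫) → FactorsAvailable Δ (σ x)
  factorsAvailable-var σ here _ fa = fa
  factorsAvailable-var σ (fun↓ s m) (fun g ows) fa =
    factorsAvailable-var σ s (VAll.lookup ows m) (factorsAvailable-fun⁻ fa (∈-substs σ m))

  mutual
    factorsAvailable-instance : ∀ {Δ r} (σ : ℕ → Term S) → OverΣE r →
                                (∀ x → var x ⊑ r → FactorsAvailable Δ (σ x)) → FactorsAvailable Δ (r ⟪ σ ⟫)
    factorsAvailable-instance σ (var x) h = h x here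
    factorsAvailable-instance σ (fun g ors) h =
      factorsAvailable-fun⁺ (factorsAvailable-instances σ ors (λ x s m → h x (fun↓ s m)))

    factorsAvailable-instances : ∀ {Δ n} {rs : Vec (Term S) n} (σ : ℕ → Term S) → VAll.All OverΣE rs →
                                 (∀ x {w} → var x ⊑ w → w ∈V rs → FactorsAvailable Δ (σ x)) →
                                 ∀ {v} → v ∈V substs rs σ → FactorsAvailable Δ v
    factorsAvailable-instances σ (o ∷ os) h (here refl) = factorsAvailable-instance σ o (λ x s → h x s (here refl))
    factorsAvailable-instances σ (o ∷ os) h (there m) = factorsAvailable-instances σ os (λ x s m' → h x s (there m')) m

module _ {S : Signature} (E : Theory S) where

  private
    _≈_ : Rel {S}
    _≈_ = _≈E_ E

  AC⇒E : ∀ {t u} → t ≡AC u → t ≈ u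
  AC⇒E = Cong-map ac

  data Generated (Δ : Ctxt) : Term S → Set where
    mem : ∀ {t} → t ∈ Δ → Generated Δ t
    fn  : ∀ f {ts} → VAll.All (Generated Δ) ts → Generated Δ (fun f ts)
    eqv : ∀ {t u} → Generated Δ t → t ≈ u → Generated Δ u

  mutual
    generated-trans : ∀ {Γ Δ t} → Generated Γ t → (∀ {x} → x ∈ Γ → Generated Δ x) → Generated Δ t
    generated-trans (mem m) h = h m
    generated-trans (fn f gs) h = fn f (generated-transs gs h)
    generated-trans (eqv g e) h = eqv (generated-trans g h) e

    generated-transs : ∀ {Γ Δ n} {ts : Vec (Term S) n} → VAll.All (Generated Γ) ts →
                       (∀ {x} → x ∈ Γ → Generated Δ x) → VAll.All (Generated Δ) ts
    generated-transs [] h = []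
    generated-transs (g ∷ gs) h = generated-trans g h ∷ generated-transs gs h

  fill-generated : ∀ {Δ k} (C : ECtx k) {Ys : Vec (Term S) k} → VAll.All (_∈ Δ) Ys → Generated Δ (fill C Ys)
  fill-generated C ms = fill-closed (Generated _) (fn _) C (VAll.map mem ms)

  -- The premise-free form of (id): t ≈E D[Ys] for an E-context D and Ys ∈ Δ.
  IdInstance : Ctxt → Term S → Set
  IdInstance Δ t = ∃ λ k → ∃ λ (D : ECtx {S} k) → ∃ λ (Ys : Vec (Term S) k) → VAll.All (_∈ Δ) Ys × t ≈ fill D Ys

  IdInstances : Ctxt → ∀ {n} → Vec (Term S) n → Set
  IdInstances Δ {n} ts = ∃ λ l → ∃ λ (Ds : ECtxs {S} n l) → ∃ λ (Ys : Vec (Term S) l) →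
                         VAll.All (_∈ Δ) Ys × Congs (EAx (rules E)) ts (fills Ds Ys)

  -- Every generated term is an instance of (id); the contexts of the arguments of
  -- a Σ_E-symbol are combined by concatenating their holes.
  mutual
    generated⇒id : ∀ {Δ t} → Generated Δ t → IdInstance Δ t
    generated⇒id {t = t} (mem m) = 1 , hole , t ∷ [] , m ∷ [] , refl
    generated⇒id (eqv g e) = let (k , D , Ys , ms , e') = generated⇒id g in k , D , Ys , ms , trans (sym e) e'
    generated⇒id (fn f gs) = let (l , Ds , Ys , ms , es) = generateds⇒id gs in l , fun f Ds , Ys , ms , fun f es

    generateds⇒id : ∀ {Δ n} {ts : Vec (Term S) n} → VAll.All (Generated Δ) ts → IdInstances Δ ts
    generateds⇒id [] = 0 , [] , [] , [] , []
    generateds⇒id {ts = t ∷ ts} (g ∷ gs) with generated⇒id g | generateds⇒id gs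
    ... | k , D , Ys , ms , e | l , Ds , Zs , ns , es =
      k + l , D ∷ Ds , Ys ++V Zs , VAllP.++⁺ ms ns ,
      subst (λ v → t ≈ fill D v) (≡-sym (take-++ Ys Zs)) e ∷
      subst (λ v → Congs (EAx (rules E)) ts (fills Ds v)) (≡-sym (drop-++ Ys Zs)) es

  derive-generated : ∀ {Δ t} → Generated Δ t → CutFree E Δ t
  derive-generated g = let (k , D , Ys , ms , e) = generated⇒id g in id D Ys (VAllP.toList⁺ ms) e

  -- The invariant of the simulation: X is represented by Δ.
  Represented : Ctxt → Term S → Set
  Represented Δ X = Generated Δ X × FactorsAvailable Δ X

  Simulates : Ctxt → Ctxt → Set
  Simulates Δ Γ = ∀ {X} → X ∈ Γ → Represented Δ X

  represented-mono : ∀ {Δ Δ' t} → Δ ⊆ Δ' → Represented Δ t → Represented Δ' t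
  represented-mono sub (g , fa) = generated-trans g (λ m → mem (sub m)) , (λ f → available-mono sub (fa f))

  represented-mem : ∀ {Δ X Y} → Y ∈ Δ → X ≡AC Y → Represented Δ X
  represented-mem m c = eqv (mem m) (AC⇒E (sym c)) , factorsAvailable-AC (sym c) (factorsAvailable-mem m)

  simulates-mono : ∀ {Δ Δ' Γ} → Δ ⊆ Δ' → Simulates Δ Γ → Simulates Δ' Γ
  simulates-mono sub G m = represented-mono sub (G m)

  simulates-∷ : ∀ {Δ Δ' Γ a a'} → Δ ⊆ Δ' → Simulates Δ Γ → a ≡AC a' → Simulates (a' ∷ Δ') (a ∷ Γ)
  simulates-∷ sub G ca (here refl) = represented-mem (here refl) ca
  simulates-∷ sub G ca (there m) = represented-mono (λ x → there (sub x)) (G m)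

  simulates-∷∷ : ∀ {Δ Δ' Γ a a' b b'} → Δ ⊆ Δ' → Simulates Δ Γ → a ≡AC a' → b ≡AC b' →
                 Simulates (a' ∷ b' ∷ Δ') (a ∷ b ∷ Γ)
  simulates-∷∷ sub G ca cb = simulates-∷ (λ x → x) (simulates-∷ sub G cb) ca

  -- To decompose an alien hypothesis X represented by Δ, work in an extension Δ'
  -- of Δ containing an AC-copy Y of X: either Δ already contains one, or one is an
  -- E-factor of Δ and an (acut) on it, justified by (id), adds it.
  with-alien : ∀ {Δ X M} → Represented Δ X → EAlien X →
               (∀ {Δ' Y} → Δ ⊆ Δ' → Y ∈ Δ' → X ≡AC Y → CutFree E Δ' M) → CutFree E Δ M
  with-alien (g , fa) al k with fa (inj₁ (al , refl))
  ... | A , c , inj₁ m = k (λ x → x) m c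
  ... | A , c , inj₂ (N , m , e) =
    acut (N , there m , e) (derive-generated (eqv g (AC⇒E c))) (k there (here refl) c)

  binary-∈ : ∀ {Δ Y a b} (op : Term S → Term S → Term S) → BinaryShape op a b Y → Y ∈ Δ →
             ∃ λ a' → ∃ λ b' → op a' b' ∈ Δ × a ≡AC a' × b ≡AC b'
  binary-∈ op (a' , b' , refl , ca , cb) m = a' , b' , m , ca , cb

  simulate : ∀ {Γ M} → CutFree E Γ M → ∀ {Δ} → Simulates Δ Γ → ∀ {M'} → M ≡AC M' → CutFree E Δ M'
  simulate (id C Xs ms e) G c =
    derive-generated (eqv (generated-trans (fill-generated C (VAllP.toList⁻ ms)) (λ m → proj₁ (G m)))
                          (trans (sym e) (AC⇒E c)))
  simulate (cut () _ _ _) G c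
  simulate (pairL {a} {b} m d) G c = with-alien (G m) (pair a b) λ sub y cy →
    let (a' , b' , y' , ca , cb) = binary-∈ pair (sameHead cy) y in
    pairL y' (simulate d (simulates-∷∷ sub G ca cb) c)
  simulate (encL {a} {K} m dK d) G c = with-alien (G m) (enc a K) λ sub y cy →
    let (a' , K' , y' , ca , cK) = binary-∈ enc (sameHead cy) y in
    encL y' (simulate dK (simulates-mono sub G) cK) (simulate d (simulates-∷∷ sub G ca cK) c)
  simulate (blindL1 {a} {K} m dK d) G c = with-alien (G m) (blind a K) λ sub y cy →
    let (a' , K' , y' , ca , cK) = binary-∈ blind (sameHead cy) y in
    blindL1 y' (simulate dK (simulates-mono sub G) cK) (simulate d (simulates-∷∷ sub G ca cK) c)
  simulate (signL {a} {K} {L} m₁ m₂ KL d) G c = with-alien (G m₁) (sign a K) λ sub₁ y₁ cy₁ →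
    let (a' , K' , y₁' , ca , cK) = binary-∈ sign (sameHead cy₁) y₁ in
    with-alien (represented-mono sub₁ (G m₂)) (pub L) λ sub₂ y₂ cy₂ →
    let (L' , eq , cL) = sameHead cy₂ in
    signL (sub₂ y₁') (subst (_∈ _) eq y₂) (trans (sym cK) (trans KL cL))
          (simulate d (simulates-∷ (λ x → sub₂ (sub₁ x)) G ca) c)
  simulate (blindL2 {a} {R} {K} m dR d) G c = with-alien (G m) (sign (blind a R) K) λ sub y cy →
    let (X , K' , y' , cX , cK) = binary-∈ sign (sameHead cy) y
        (a' , R' , eq , ca , cR) = sameHead cX in
    blindL2 (subst (λ Z → sign Z K' ∈ _) eq y') (simulate dR (simulates-mono sub G) cR)
            (simulate d (simulates-∷∷ sub G (sign ca cK) cR) c)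
  simulate (acut (_ , here refl , e) dA d) G {M'} c =
    let (A' , cA , e') = proj₁ (⊆F-AC c) e in
    acut (M' , here refl , e') (simulate dA G cA) (simulate d (simulates-∷ (λ x → x) G cA) c)
  -- an (acut) on an E-factor of a hypothesis is redundant or an (acut) on an E-factor of Δ
  simulate (acut (_ , there zm , e) dA d) G c with proj₂ (G zm) (inj₂ e)
  ... | A' , cA , inj₁ am = simulate d (λ { (here refl) → represented-mem am cA ; (there m) → G m }) c
  ... | A' , cA , inj₂ (N , m , e') =
    acut (N , there m , e') (simulate dA G cA) (simulate d (simulates-∷ (λ x → x) G cA) c)
  simulate (pairR d₁ d₂) G c with sameHead c
  ... | _ , _ , refl , c₁ , c₂ = pairR (simulate d₁ G c₁) (simulate d₂ G c₂)
  simulate (encR d₁ d₂) G c with sameHead c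
  ... | _ , _ , refl , c₁ , c₂ = encR (simulate d₁ G c₁) (simulate d₂ G c₂)
  simulate (signR d₁ d₂) G c with sameHead c
  ... | _ , _ , refl , c₁ , c₂ = signR (simulate d₁ G c₁) (simulate d₂ G c₂)
  simulate (blindR d₁ d₂) G c with sameHead c
  ... | _ , _ , refl , c₁ , c₂ = blindR (simulate d₁ G c₁) (simulate d₂ G c₂)

  private
    ℛ : List (Rule S)
    ℛ = rules E

  mutual
    step⇒E : ∀ {t u} → Step ℛ t u → t ≈ u
    step⇒E (root rm σ) = ax (rule rm σ)
    step⇒E (pub st) = pub (step⇒E st)
    step⇒E (sign₁ st) = sign (step⇒E st) refl
    step⇒E (sign₂ st) = sign refl (step⇒E st)
    step⇒E (blind₁ st) = blind (step⇒E st) refl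
    step⇒E (blind₂ st) = blind refl (step⇒E st)
    step⇒E (pair₁ st) = pair (step⇒E st) refl
    step⇒E (pair₂ st) = pair refl (step⇒E st)
    step⇒E (enc₁ st) = enc (step⇒E st) refl
    step⇒E (enc₂ st) = enc refl (step⇒E st)
    step⇒E (fun f sts) = fun f (steps⇒E sts)

    steps⇒E : ∀ {n} {ts us : Vec (Term S) n} → Steps ℛ ts us → Congs (EAx ℛ) ts us
    steps⇒E (here st) = step⇒E st ∷ Congs-refl
    steps⇒E (there sts) = refl ∷ steps⇒E sts

  rewrite⇒E : ∀ {t u} → _⟶AC*_ ℛ t u → t ≈ u
  rewrite⇒E ε = refl
  rewrite⇒E ((_ , _ , c , st , c') ◅ rest) = trans (AC⇒E c) (trans (step⇒E st) (trans (AC⇒E c') (rewrite⇒E rest)))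

  under : ∀ {a} (h : Term S → Term S) → (∀ {x y} → Step ℛ x y → Step ℛ (h x) (h y)) →
          (∀ {x y} → x ≡AC y → h x ≡AC h y) → ∃ (_⟶AC_ ℛ a) → ∃ (_⟶AC_ ℛ (h a))
  under h hs hc (z , t' , u' , c , st , c') = h z , h t' , h u' , hc c , hs st , hc c'

  reducible-⊑ : ∀ {A Y w} → A ⊑ Y → _⟶AC_ ℛ A w → ∃ λ z → _⟶AC_ ℛ Y z
  reducible-⊑ here st = _ , st
  reducible-⊑ (pub↓ s) st = under pub pub pub (reducible-⊑ s st)
  reducible-⊑ (sign₁ {v = v} s) st = under (λ a → sign a v) sign₁ (λ c → sign c refl) (reducible-⊑ s st)
  reducible-⊑ (sign₂ {u = v} s) st = under (sign v) sign₂ (sign refl) (reducible-⊑ s st)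
  reducible-⊑ (blind₁ {v = v} s) st = under (λ a → blind a v) blind₁ (λ c → blind c refl) (reducible-⊑ s st)
  reducible-⊑ (blind₂ {u = v} s) st = under (blind v) blind₂ (blind refl) (reducible-⊑ s st)
  reducible-⊑ (pair₁ {v = v} s) st = under (λ a → pair a v) pair₁ (λ c → pair c refl) (reducible-⊑ s st)
  reducible-⊑ (pair₂ {u = v} s) st = under (pair v) pair₂ (pair refl) (reducible-⊑ s st)
  reducible-⊑ (enc₁ {v = v} s) st = under (λ a → enc a v) enc₁ (λ c → enc c refl) (reducible-⊑ s st)
  reducible-⊑ (enc₂ {u = v} s) st = under (enc v) enc₂ (enc refl) (reducible-⊑ s st)
  reducible-⊑ (fun↓ {f = f} s m) st = under-fun m (reducible-⊑ s st)
    where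
      at : ∀ {n} {ts : Vec (Term S) n} {w t' u'} → w ∈V ts → w ≡AC t' → Step ℛ t' u' →
           ∃ λ ts' → ∃ λ us' → Congs ACAx ts ts' × Steps ℛ ts' us'
      at {ts = _ ∷ ts} {t' = t'} {u'} (here refl) c st' = t' ∷ ts , u' ∷ ts , c ∷ Congs-refl , here st'
      at {ts = t ∷ _} (there m') c st' = let (ts' , us' , cs , sts) = at m' c st' in
        t ∷ ts' , t ∷ us' , refl ∷ cs , there sts

      under-fun : ∀ {w ts} → w ∈V ts → ∃ (_⟶AC_ ℛ w) → ∃ (_⟶AC_ ℛ (fun f ts))
      under-fun m' (_ , t' , u' , c , st' , c') = let (ts' , us' , cs , sts) = at m' c st' in
        fun f us' , fun f ts' , fun f us' , fun f cs , fun f sts , refl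

  module _ {Δ : Ctxt} (Δ-normal : ∀ {Y} → Y ∈ Δ → Normal E Y) where

    -- An available term is irreducible: up to AC it is a subterm of a member of Δ.
    available-irreducible : ∀ {t u} → Available Δ t → ¬ Step ℛ t u
    available-irreducible (A , c , inj₁ m) st = Δ-normal m (_ , _ , _ , sym c , st , refl)
    available-irreducible (A , c , inj₂ (Y , m , (_ , _ , _ , s , mA))) st =
      Δ-normal m (reducible-⊑ (⊑-trans (fun↓ here mA) s) (_ , _ , sym c , st , refl))

    -- Hence no step happens at an alien term with available factors: a step
    -- either applies a Σ_E-rule at the root or lies below a Σ_E-symbol.
    alien-irreducible : ∀ {t u} → FactorsAvailable Δ t → EAlien t → ¬ Step ℛ t u
    alien-irreducible fa al = available-irreducible (fa (inj₁ (al , refl)))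

    -- One step: at the root it instantiates a Σ_E-rule l → r whose variables all
    -- occur in l, below a Σ_E-symbol it acts on one argument, and elsewhere it
    -- would be a step at an alien.
    mutual
      factorsAvailable-step : ∀ {t u} → FactorsAvailable Δ t → Step ℛ t u → FactorsAvailable Δ u
      factorsAvailable-step fa (root {r} _ σ) =
        factorsAvailable-instance σ (rhsΣE r) (λ x s → factorsAvailable-var σ (varsRL r x s) (lhsΣE r) fa)
      factorsAvailable-step fa st@(pub _) = ⊥-elim (alien-irreducible fa (pub _) st)
      factorsAvailable-step fa st@(sign₁ _) = ⊥-elim (alien-irreducible fa (sign _ _) st)
      factorsAvailable-step fa st@(sign₂ _) = ⊥-elim (alien-irreducible fa (sign _ _) st)
      factorsAvailable-step fa st@(blind₁ _) = ⊥-elim (alien-irreducible fa (blind _ _) st)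
      factorsAvailable-step fa st@(blind₂ _) = ⊥-elim (alien-irreducible fa (blind _ _) st)
      factorsAvailable-step fa st@(pair₁ _) = ⊥-elim (alien-irreducible fa (pair _ _) st)
      factorsAvailable-step fa st@(pair₂ _) = ⊥-elim (alien-irreducible fa (pair _ _) st)
      factorsAvailable-step fa st@(enc₁ _) = ⊥-elim (alien-irreducible fa (enc _ _) st)
      factorsAvailable-step fa st@(enc₂ _) = ⊥-elim (alien-irreducible fa (enc _ _) st)
      factorsAvailable-step fa (fun f sts) =
        factorsAvailable-fun⁺ (factorsAvailable-steps (factorsAvailable-fun⁻ fa) sts)

      factorsAvailable-steps : ∀ {n} {ts us : Vec (Term S) n} → (∀ {v} → v ∈V ts → FactorsAvailable Δ v) →
                               Steps ℛ ts us → ∀ {v} → v ∈V us → FactorsAvailable Δ v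
      factorsAvailable-steps h (here st) (here refl) = factorsAvailable-step (h (here refl)) st
      factorsAvailable-steps h (here st) (there m) = h (there m)
      factorsAvailable-steps h (there sts) (here refl) = h (here refl)
      factorsAvailable-steps h (there sts) (there m) = factorsAvailable-steps (λ m' → h (there m')) sts m

    factorsAvailable-rewrite : ∀ {t u} → FactorsAvailable Δ t → _⟶AC*_ ℛ t u → FactorsAvailable Δ u
    factorsAvailable-rewrite fa ε = fa
    factorsAvailable-rewrite fa ((_ , _ , c , st , c') ◅ rest) =
      factorsAvailable-rewrite (factorsAvailable-AC c' (factorsAvailable-step (factorsAvailable-AC c fa) st)) rest

lemma3p11 : (S : Signature) (E : Theory S) (k : ℕ) (C : ECtx {S} k)
            (Ms : Vec (Term S) k) (Γ : List (Term S)) (M N : Term S) →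
            All (NormalMsg E) (toList Ms) → All (NormalMsg E) Γ → NormalMsg E M →
            IsNormalFormOf E N (fill C Ms) →
            CutFree E (N ∷ Γ) M → CutFree E (toList Ms ++ Γ) M
lemma3p11 S E k C Ms Γ M N Ms-normal Γ-normal _ (C[Ms]⟶*N , _) d = simulate E d Δ-simulates refl
  where
    Δ : List (Term S)
    Δ = toList Ms ++ Γ

    Δ-normal : ∀ {Y} → Y ∈ Δ → Normal E Y
    Δ-normal m = proj₂ (All-lookup (AllP.++⁺ Ms-normal Γ-normal) m)

    Ms⊆Δ : VAll.All (_∈ Δ) Ms
    Ms⊆Δ = VAllP.toList⁻ (All-tabulate ∈-++⁺ˡ)

    C[Ms]-available : FactorsAvailable Δ (fill C Ms)
    C[Ms]-available = fill-closed (FactorsAvailable Δ) (λ fas → factorsAvailable-fun⁺ (VAll.lookup fas)) C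
                                  (VAll.map factorsAvailable-mem Ms⊆Δ)

    Δ-simulates : Simulates E Δ (N ∷ Γ)
    Δ-simulates (here refl) = eqv (fill-generated E C Ms⊆Δ) (rewrite⇒E E C[Ms]⟶*N) ,
                              factorsAvailable-rewrite E Δ-normal C[Ms]-available C[Ms]⟶*N
    Δ-simulates (there m) = represented-mem E (∈-++⁺ʳ (toList Ms) m) refl
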